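{- Let $\mathcal{T}$ be a Kripke transition system, let $\alpha$ be a HyperPDL-$\Delta$ program in scope of $n$ path quantifiers (binding $\pi_1,\dots,\pi_n$), and let $M_\alpha=(Q,q_0,\Sigma^n,\rho,q_f,\Psi)$ be the automaton associated with $\alpha$ (described in the context). Let $\Pi$ be a path assignment with $\mathit{dom}(\Pi)=\{\epsilon,\pi_1,\dots,\pi_n\}$, and for each odd $j$ let $\tau_j=(\Pi(\pi_1)(j),\dots,\Pi(\pi_n)(j))\in\Sigma^n$. Then for all even numbers $i\le k$: $(\Pi,i,k)\in R(\alpha)$ if and only if there are states $q_0',q_1',\dots,q_m'$ of $M_\alpha$ with $m=\frac{k-i}{2}$ and sets of formulas $X_0,\dots,X_m$ such that (i) $q_0'$ is the initial state $q_0$ of $M_\alpha$; (ii) $q_m' \xRightarrow{\varepsilon}_{X_m} q_f$, where $q_f$ is the final state of $M_\alpha$; (iii) $q_l' \xRightarrow{\tau_{i+2l+1}}_{X_l} q_{l+1}'$ for all $l<m$; (iv) for all $l\le m$ and all $\psi\in X_l$: $\Pi[i+2l,\infty]\models_{\mathcal{T}}\psi$.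
   Context: Let $AP$ be a finite set of atomic propositions and $\Sigma$ a finite set of atomic programs. A Kripke transition system (KTS) is $\mathcal{T}=(S,s_0,\{\delta_\sigma\mid\sigma\in\Sigma\},L)$ with $S$ finite, $s_0\in S$, $\delta_\sigma\subseteq S\times S$, $L:S\to 2^{AP}$, and every state has an outgoing edge in some $\delta_\sigma$. A path is an infinite alternating sequence $s_0\sigma_0s_1\sigma_1\dots\in(S\Sigma)^\omega$ with $(s_i,s_{i+1})\in\delta_{\sigma_i}$; positions are counted in this alternating sequence (even positions carry states, odd positions carry programs). $\mathit{Paths}(\mathcal{T},s)$ is the set of paths whose first state is $s$, and $\mathit{Paths}^*(\mathcal{T},s)$ the set of their suffixes $p[i,\infty]$. HyperPDL-$\Delta$ syntax (with path variables $\epsilon,\pi_1,\pi_2,\dots$): formulas $\varphi::=\exists\pi.\varphi\mid\forall\pi.\varphi\mid a_\pi\mid\neg\varphi\mid\varphi\wedge\varphi\mid\varphi\vee\varphi\mid\langle\alpha\rangle\varphi\mid[\alpha]\varphi\mid\Delta\alpha$ and programs $\alpha::=\tau\mid\varepsilon\mid\alpha+\alpha\mid\alpha\cdot\alpha\mid\alpha^*\mid\varphi?$, where $a\in AP$, $\pi\neq\epsilon$, and $\tau\in(\Sigma\cup\{\cdot\})^n$ with $n$ the number of quantifiers in whose scope the program stands; the quantifier in scope of $i-1$ quantifiers binds $\pi_i$, and component $l$ of $\tau$ refers to $\pi_l$ ($\cdot$ is a wildcard). A path assignment $\Pi$ is a partial map from path variables to $\mathit{Paths}^*(\mathcal{T},s_0)$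 with domain $\{\epsilon,\pi_1,\dots,\pi_n\}$; $\Pi[i,\infty](\pi)=\Pi(\pi)[i,\infty]$, and $\Pi[\pi\to p]$ is the update. Semantics: $\Pi\models\exists\pi.\varphi$ iff some $p\in\mathit{Paths}(\mathcal{T},\Pi(\epsilon)(0))$ has $\Pi[\pi\to p,\epsilon\to p]\models\varphi$; $\forall$ dually; $\Pi\models a_\pi$ iff $a\in L(\Pi(\pi)(0))$; Boolean connectives as usual; $\Pi\models\langle\alpha\rangle\varphi$ iff there is $i\ge0$ with $(\Pi,0,i)\in R(\alpha)$ and $\Pi[i,\infty]\models\varphi$; $\Pi\models[\alpha]\varphi$ iff for all $i$ with $(\Pi,0,i)\in R(\alpha)$, $\Pi[i,\infty]\models\varphi$; $\Pi\models\Delta\alpha$ iff there are $0=k_1\le k_2\le\dots$ with $(\Pi,k_j,k_{j+1})\in R(\alpha)$ for all $j\ge1$. For even $i\le k$: $(\Pi,i,k)\in R(\tau)$ iff $k=i+2$ and for all $l$, $\tau|_l=\cdot$ or $\Pi(\pi_l)(i+1)=\tau|_l$; $R(\varepsilon)$: $i=k$; $R(\alpha_1+\alpha_2)=R(\alpha_1)\cup R(\alpha_2)$; $(\Pi,i,k)\in R(\alpha_1\cdot\alpha_2)$ iff some $i\le j\le k$ has $(\Pi,i,j)\in R(\alpha_1)$, $(\Pi,j,k)\in R(\alpha_2)$; $(\Pi,i,k)\in R(\alpha^*)$ iff there are $i=j_0\le\dots\le j_l=k$ ($l\ge0$) with each $(\Pi,j_m,j_{m+1})\in R(\alpha)$;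 $(\Pi,i,k)\in R(\varphi?)$ iff $i=k$ and $\Pi[i,\infty]\models\varphi$. The automaton $M_\alpha=(Q,q_0,\Sigma^n,\rho,q_f,\Psi)$ is an NFA with $\varepsilon$-edges, a single initial state $q_0$, a single final state $q_f$, transition function $\rho$ (on letters of $\Sigma^n$ and on $\varepsilon$), and marking $\Psi$ assigning to each state a set of at most one formula; it is built inductively: for $\tau$: states $q_0,q_1$ with a transition $q_0\to q_1$ on every letter $(\sigma_1,\dots,\sigma_n)$ such that $\tau|_i\in\{\cdot,\sigma_i\}$ for all $i$; for $\varepsilon$: $q_0\xrightarrow{\varepsilon}q_1$; for $\alpha_1+\alpha_2$: disjoint union plus new unmarked $q_0,q_f$ with $\varepsilon$-edges from $q_0$ to both old initial states and from both old final states to $q_f$; for $\alpha_1\cdot\alpha_2$: disjoint union with an $\varepsilon$-edge from the final state of $M_{\alpha_1}$ to the initial state of $M_{\alpha_2}$ (initial state of $M_{\alpha_1}$, final state of $M_{\alpha_2}$); for $\alpha_1^*$: new unmarked $q_0,q_f$ with $\varepsilon$-edges $q_0\to q_{0,1}$, $q_0\to q_f$, $q_f\to q_0$, and final state of $M_{\alpha_1}$ $\to q_f$; for $\psi?$: states $q_0\xrightarrow{\varepsilon}q_1\xrightarrow{\varepsilon}q_2$ with $\Psi(q_1)=\{\psi\}$. All other states are unmarked. $\xRightarrow{\varepsilon}_X$ is the smallest relation with $q\xRightarrow{\varepsilon}_{\Psi(q)}q$, and if $q'\in\rho(q,\varepsilon)$ and $q'\xRightarrow{\varepsilon}_X q''$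 then $q\xRightarrow{\varepsilon}_{X\cup\Psi(q)}q''$. For a letter $\tau\in\Sigma^n$, $q\xRightarrow{\tau}_X q''$ iff there is $q'$ with $q\xRightarrow{\varepsilon}_X q'$ and $q''\in\rho(q',\tau)$. -}

module Defs where

open import Data.Nat using (ℕ; zero; suc; _+_; _*_; _≤_)
open import Data.Fin using (Fin; zero; suc)
open import Data.Fin.Subset using (Subset; _∈_)
open import Data.Bool using (Bool; T)
open import Data.Maybe using (Maybe; just; nothing)
open import Data.Sum using (_⊎_; inj₁; inj₂)
open import Data.Product using (Σ; ∃; ∃-syntax; _×_; _,_)
open import Data.Unit using (⊤)
open import Data.List using (List; []; _∷_; _++_)
open import Relation.Nullary using (¬_)
open import Relation.Binary.PropositionalEquality using (_≡_)
open import Relation.Binary.Construct.Closure.ReflexiveTransitive using (Star)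

-- Kripke transition systems over AP = Fin nAP and Σ = Fin nΣ.
-- S = Fin nS; δ σ s s' = true  iff (s , s') ∈ δ_σ; L s ⊆ AP.

record KTS (nAP nΣ : ℕ) : Set where
  field
    nS    : ℕ
    s₀    : Fin nS
    δ     : Fin nΣ → Fin nS → Fin nS → Bool
    L     : Fin nS → Subset nAP
    total : ∀ s → ∃[ σ ] ∃[ s' ] T (δ σ s s')

open KTS public

-- Alternating sequences s₀ σ₀ s₁ σ₁ … : position j of the sequence.
-- Even positions should carry states (inj₁), odd positions programs (inj₂).
Seq : ∀ {nAP nΣ} → KTS nAP nΣ → Set
Seq {nΣ = nΣ} 𝒯 = ℕ → Fin (nS 𝒯) ⊎ Fin nΣ

IsPath : ∀ {nAP nΣ} (𝒯 : KTS nAP nΣ) → Seq 𝒯 → Set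
IsPath 𝒯 p = ∀ j → ∃[ s ] ∃[ σ ] ∃[ s' ]
  (p (2 * j) ≡ inj₁ s × p (suc (2 * j)) ≡ inj₂ σ × p (2 + 2 * j) ≡ inj₁ s'
   × T (δ 𝒯 σ s s'))

InPaths : ∀ {nAP nΣ} (𝒯 : KTS nAP nΣ) → Fin (nS 𝒯) → Seq 𝒯 → Set
InPaths 𝒯 s p = IsPath 𝒯 p × p 0 ≡ inj₁ s

suffix : ∀ {nAP nΣ} (𝒯 : KTS nAP nΣ) → Seq 𝒯 → ℕ → Seq 𝒯
suffix 𝒯 p i = λ x → p (i + x)

InPaths* : ∀ {nAP nΣ} (𝒯 : KTS nAP nΣ) → Seq 𝒯 → Set
InPaths* 𝒯 p = ∃[ p' ] ∃[ j ] (InPaths 𝒯 (s₀ 𝒯) p' × (∀ x → p x ≡ p' (2 * j + x)))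

-- Syntax.  n = number of quantifiers in scope.
-- Path variables in scope n: ε, and π_{l+1} for l : Fin n.

data Var (n : ℕ) : Set where
  ε : Var n
  π : Fin n → Var n

-- letters of Σⁿ, and program letters τ ∈ (Σ ∪ {·})ⁿ (nothing = ·)
Letter : ℕ → ℕ → Set
Letter nΣ n = Fin n → Fin nΣ

mutual
  data Form {nAP nΣ : ℕ} (n : ℕ) : Set where
    ∃π_ ∀π_   : Form {nAP} {nΣ} (suc n) → Form {nAP} {nΣ} n
    atom      : Fin nAP → Var n → Form {nAP} {nΣ} n
    ¬'_       : Form {nAP} {nΣ} n → Form {nAP} {nΣ} n
    _∧'_ _∨'_ : Form {nAP} {nΣ} n → Form {nAP} {nΣ} n → Form {nAP} {nΣ} n
    ⟨_⟩_ [_]_ : Prog {nAP} {nΣ} n → Form {nAP} {nΣ} n → Form {nAP} {nΣ} n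
    Δ         : Prog {nAP} {nΣ} n → Form {nAP} {nΣ} n

  data Prog {nAP nΣ : ℕ} (n : ℕ) : Set where
    τ    : (Fin n → Maybe (Fin nΣ)) → Prog {nAP} {nΣ} n
    eps  : Prog {nAP} {nΣ} n
    _+'_ : Prog {nAP} {nΣ} n → Prog {nAP} {nΣ} n → Prog {nAP} {nΣ} n
    _·_  : Prog {nAP} {nΣ} n → Prog {nAP} {nΣ} n → Prog {nAP} {nΣ} n
    _*'  : Prog {nAP} {nΣ} n → Prog {nAP} {nΣ} n
    _¿   : Form {nAP} {nΣ} n → Prog {nAP} {nΣ} n

-- Path assignments: Π = (Π(ε) , l ↦ Π(π_{l+1}))

record PA {nAP nΣ} (𝒯 : KTS nAP nΣ) (n : ℕ) : Set where
  constructor _,_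
  field
    Πε : Seq 𝒯
    Ππ : Fin n → Seq 𝒯

open PA public

lookupΠ : ∀ {nAP nΣ} {𝒯 : KTS nAP nΣ} {n} → PA 𝒯 n → Var n → Seq 𝒯
lookupΠ (e , ps) ε = e
lookupΠ (e , ps) (π l) = ps l

shiftΠ : ∀ {nAP nΣ} {𝒯 : KTS nAP nΣ} {n} → PA 𝒯 n → ℕ → PA 𝒯 n
shiftΠ {𝒯 = 𝒯} (e , ps) i = suffix 𝒯 e i , λ l → suffix 𝒯 (ps l) i

snoc : ∀ {A : Set} {n} → (Fin n → A) → A → Fin (suc n) → A
snoc {n = zero} f a zero = a
snoc {n = suc n} f a zero = f zero
snoc {n = suc n} f a (suc i) = snoc (λ j → f (suc j)) a i

extendΠ : ∀ {nAP nΣ} {𝒯 : KTS nAP nΣ} {n} → PA 𝒯 n → Seq 𝒯 → PA 𝒯 (suc n)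
extendΠ (e , ps) p = p , snoc ps p

HoldsAt : ∀ {nAP nΣ} (𝒯 : KTS nAP nΣ) → Fin nAP → Fin (nS 𝒯) ⊎ Fin nΣ → Set
HoldsAt 𝒯 a x = ∃[ s ] (x ≡ inj₁ s × a ∈ L 𝒯 s)

MatchProg : ∀ {nS nΣ} → Maybe (Fin nΣ) → Fin nS ⊎ Fin nΣ → Set
MatchProg nothing x = ⊤
MatchProg (just σ) x = x ≡ inj₂ σ

mutual
  _⊨_ : ∀ {nAP nΣ} {𝒯 : KTS nAP nΣ} {n} → PA 𝒯 n → Form {nAP} {nΣ} n → Set
  _⊨_ {𝒯 = 𝒯} Π (∃π φ) = ∃[ p ] (IsPath 𝒯 p × p 0 ≡ lookupΠ Π ε 0 × extendΠ Π p ⊨ φ)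
  _⊨_ {𝒯 = 𝒯} Π (∀π φ) = ∀ p → IsPath 𝒯 p → p 0 ≡ lookupΠ Π ε 0 → extendΠ Π p ⊨ φ
  _⊨_ {𝒯 = 𝒯} Π (atom a v) = HoldsAt 𝒯 a (lookupΠ Π v 0)
  Π ⊨ (¬' φ) = ¬ (Π ⊨ φ)
  Π ⊨ (φ ∧' ψ) = (Π ⊨ φ) × (Π ⊨ ψ)
  Π ⊨ (φ ∨' ψ) = (Π ⊨ φ) ⊎ (Π ⊨ ψ)
  Π ⊨ (⟨ α ⟩ φ) = ∃[ i ] (R α Π 0 i × shiftΠ Π i ⊨ φ)
  Π ⊨ ([ α ] φ) = ∀ i → R α Π 0 i → shiftΠ Π i ⊨ φ
  Π ⊨ (Δ α) = Σ (ℕ → ℕ) λ k → (k 0 ≡ 0 × (∀ j → k j ≤ k (suc j) × R α Π (k j) (k (suc j))))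

  R : ∀ {nAP nΣ} {𝒯 : KTS nAP nΣ} {n} → Prog {nAP} {nΣ} n → PA 𝒯 n → ℕ → ℕ → Set
  R (τ t) Π i k = k ≡ i + 2 × (∀ l → MatchProg (t l) (lookupΠ Π (π l) (suc i)))
  R eps Π i k = i ≡ k
  R (α +' β) Π i k = R α Π i k ⊎ R β Π i k
  R (α · β) Π i k = ∃[ j ] (i ≤ j × j ≤ k × R α Π i j × R β Π j k)
  R (α *') Π i k = Star (λ j j' → j ≤ j' × R α Π j j') i k
  R (φ ¿) Π i k = i ≡ k × shiftΠ Π i ⊨ φ

module _ {nAP nΣ : ℕ} {n : ℕ} where

  private
    P : Set
    P = Prog {nAP} {nΣ} n

  Q : Prog {nAP} {nΣ} n → Set
  Q (τ t) = Fin 2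
  Q eps = Fin 2
  Q (α +' β) = Fin 2 ⊎ (Q α ⊎ Q β)     -- inj₁ 0 = new q₀, inj₁ 1 = new q_f
  Q (α · β) = Q α ⊎ Q β
  Q (α *') = Fin 2 ⊎ Q α              -- inj₁ 0 = new q₀, inj₁ 1 = new q_f
  Q (φ ¿) = Fin 3

  q₀ : (α : Prog {nAP} {nΣ} n) → Q α
  q₀ (τ t) = zero
  q₀ eps = zero
  q₀ (α +' β) = inj₁ zero
  q₀ (α · β) = inj₁ (q₀ α)
  q₀ (α *') = inj₁ zero
  q₀ (φ ¿) = zero

  q_f : (α : Prog {nAP} {nΣ} n) → Q α
  q_f (τ t) = suc zero
  q_f eps = suc zero
  q_f (α +' β) = inj₁ (suc zero)
  q_f (α · β) = inj₂ (q_f β)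
  q_f (α *') = inj₁ (suc zero)
  q_f (φ ¿) = suc (suc zero)

  Ψ : (α : Prog {nAP} {nΣ} n) → Q α → List (Form {nAP} {nΣ} n)
  Ψ (τ t) q = []
  Ψ eps q = []
  Ψ (α +' β) (inj₁ q) = []
  Ψ (α +' β) (inj₂ (inj₁ q)) = Ψ α q
  Ψ (α +' β) (inj₂ (inj₂ q)) = Ψ β q
  Ψ (α · β) (inj₁ q) = Ψ α q
  Ψ (α · β) (inj₂ q) = Ψ β q
  Ψ (α *') (inj₁ q) = []
  Ψ (α *') (inj₂ q) = Ψ α q
  Ψ (φ ¿) zero = []
  Ψ (φ ¿) (suc zero) = φ ∷ []
  Ψ (φ ¿) (suc (suc zero)) = []

  -- q' ∈ ρ(q, a), where a = nothing is an ε-edge and a = just w a letter w ∈ Σⁿ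
  data ρ : (α : Prog {nAP} {nΣ} n) → Q α → Maybe (Letter nΣ n) → Q α → Set where
    τ-edge  : ∀ {t} (w : Letter nΣ n) → (∀ l → MatchProg {nS = 0} (t l) (inj₂ (w l))) →
              ρ (τ t) zero (just w) (suc zero)
    ε-edge  : ρ eps zero nothing (suc zero)
    +-in₁   : ∀ {α β : P} → ρ (α +' β) (inj₁ zero) nothing (inj₂ (inj₁ (q₀ α)))
    +-in₂   : ∀ {α β : P} → ρ (α +' β) (inj₁ zero) nothing (inj₂ (inj₂ (q₀ β)))
    +-out₁  : ∀ {α β : P} → ρ (α +' β) (inj₂ (inj₁ (q_f α))) nothing (inj₁ (suc zero))
    +-out₂  : ∀ {α β : P} → ρ (α +' β) (inj₂ (inj₂ (q_f β))) nothing (inj₁ (suc zero))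
    +-lift₁ : ∀ {α β : P} {q a q'} → ρ α q a q' → ρ (α +' β) (inj₂ (inj₁ q)) a (inj₂ (inj₁ q'))
    +-lift₂ : ∀ {α β : P} {q a q'} → ρ β q a q' → ρ (α +' β) (inj₂ (inj₂ q)) a (inj₂ (inj₂ q'))
    ·-mid   : ∀ {α β : P} → ρ (α · β) (inj₁ (q_f α)) nothing (inj₂ (q₀ β))
    ·-lift₁ : ∀ {α β : P} {q a q'} → ρ α q a q' → ρ (α · β) (inj₁ q) a (inj₁ q')
    ·-lift₂ : ∀ {α β : P} {q a q'} → ρ β q a q' → ρ (α · β) (inj₂ q) a (inj₂ q')
    *-in    : ∀ {α : P} → ρ (α *') (inj₁ zero) nothing (inj₂ (q₀ α))
    *-skip  : ∀ {α : P} → ρ (α *') (inj₁ zero) nothing (inj₁ (suc zero))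
    *-back  : ∀ {α : P} → ρ (α *') (inj₁ (suc zero)) nothing (inj₁ zero)
    *-out   : ∀ {α : P} → ρ (α *') (inj₂ (q_f α)) nothing (inj₁ (suc zero))
    *-lift  : ∀ {α : P} {q a q'} → ρ α q a q' → ρ (α *') (inj₂ q) a (inj₂ q')
    ¿-01    : ∀ {φ : Form {nAP} {nΣ} n} → ρ (φ ¿) zero nothing (suc zero)
    ¿-12    : ∀ {φ : Form {nAP} {nΣ} n} → ρ (φ ¿) (suc zero) nothing (suc (suc zero))

  -- q ⇒ε_X q''   (sets of formulas represented as lists; X ∪ Ψ(q) as X ++ Ψ q)
  data _⊢_⇒ε[_]_ (α : Prog {nAP} {nΣ} n) : Q α → List (Form {nAP} {nΣ} n) → Q α → Set where
    ⇒ε-refl : ∀ {q} → α ⊢ q ⇒ε[ Ψ α q ] q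
    ⇒ε-step : ∀ {q q' q'' X} → ρ α q nothing q' → α ⊢ q' ⇒ε[ X ] q'' →
              α ⊢ q ⇒ε[ X ++ Ψ α q ] q''

  _⊢_⇒⟨_⟩[_]_ : (α : Prog {nAP} {nΣ} n) → Q α → Letter nΣ n → List (Form {nAP} {nΣ} n) → Q α → Set
  α ⊢ q ⇒⟨ w ⟩[ X ] q'' = ∃[ q' ] (α ⊢ q ⇒ε[ X ] q' × ρ α q' (just w) q'')

-- τ_j = (Π(π_1)(j), …, Π(π_n)(j)) ∈ Σⁿ, as a relation: IsLetterAt Π j w iff τ_j = w
IsLetterAt : ∀ {nAP nΣ} {𝒯 : KTS nAP nΣ} {n} → PA 𝒯 n → ℕ → Letter nΣ n → Set
IsLetterAt Π j w = ∀ l → lookupΠ Π (π l) j ≡ inj₂ (w l)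

module Submission where

-- The proof goes through an intermediate notion of a *checked run* of M_α (Run below): a
-- sequence of single edges from position i to position k in which an ε-edge stays at the
-- current position, a letter edge reads τ_{i+1} and advances by two, and the mark Ψ(q) of
-- every visited state q holds at the current position.

open import Defs
open import Data.Nat using (ℕ; zero; suc; _+_; _*_; _∸_; _≤_; ⌊_/2⌋)
open import Data.Nat.Properties using (+-identityʳ; +-comm; *-comm; +-cancelˡ-≡; *-cancelˡ-≡; m+[n∸m]≡n; ≤-refl; ≤-trans; m≤n+m)
open import Data.Nat.Divisibility using (_∣_; divides; ∣-refl; ∣m∣n⇒∣m+n; ∣m+n∣m⇒∣n)
open import Data.Nat.Tactic.RingSolver using (solve-∀)
open import Data.Fin using (Fin; zero; suc; fromℕ; inject₁; toℕ)
open import Data.List using (List; []; _∷_; _++_)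
open import Data.List.Membership.Propositional using (_∈_)
open import Data.List.Membership.Propositional.Properties using (∈-++⁺ˡ; ∈-++⁺ʳ; ∈-++⁻)
open import Data.List.Relation.Unary.Any using (here)
open import Data.Product using (Σ; ∃-syntax; _×_; _,_; proj₁; proj₂)
open import Data.Sum using (_⊎_; inj₁; inj₂; [_,_]′)
open import Data.Maybe using (Maybe; just; nothing)
open import Data.Unit using (tt)
open import Data.Empty using (⊥-elim)
open import Relation.Nullary using (¬_)
open import Function.Bundles using (_⇔_; mk⇔)
open import Relation.Binary.PropositionalEquality using (_≡_; refl; sym; trans; cong; subst; module ≡-Reasoning)
open import Relation.Binary.Construct.Closure.ReflexiveTransitive using (Star; ε; _◅_)

open ≡-Reasoning

-- After one letter block starting at i + 2, the remaining m blocks end where m + 1 blocks from i end.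
next-block : ∀ i m → suc (suc i) + 2 * m ≡ i + 2 * suc m
next-block = solve-∀

first-letter : ∀ i → suc i ≡ i + 2 * 0 + 1
first-letter = solve-∀

-- The odd position after the even position 2a in the path p' with p = p'[2j, ∞].
odd-position : ∀ j a → 2 * j + suc (a * 2) ≡ suc (2 * (j + a))
odd-position = solve-∀

half-double : ∀ c → ⌊ c * 2 /2⌋ ≡ c
half-double zero = refl
half-double (suc c) = cong suc (half-double c)

even-gap : ∀ {i k} → 2 ∣ i → 2 ∣ k → i ≤ k → k ≡ i + 2 * ⌊ (k ∸ i) /2⌋
even-gap {i} {k} 2∣i 2∣k i≤k with ∣m+n∣m⇒∣n (subst (2 ∣_) (sym (m+[n∸m]≡n i≤k)) 2∣k) 2∣i
... | divides c gap≡ = begin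
  k                        ≡⟨ m+[n∸m]≡n i≤k ⟨
  i + (k ∸ i)              ≡⟨ cong (i +_) gap≡ ⟩
  i + c * 2                ≡⟨ cong (i +_) (*-comm c 2) ⟩
  i + 2 * c                ≡⟨ cong (λ x → i + 2 * x) (half-double c) ⟨
  i + 2 * ⌊ c * 2 /2⌋      ≡⟨ cong (λ x → i + 2 * ⌊ x /2⌋) gap≡ ⟨
  i + 2 * ⌊ (k ∸ i) /2⌋    ∎

steps-unique : ∀ i {m m'} → i + 2 * m ≡ i + 2 * m' → m ≡ m'
steps-unique i {m} {m'} eq = *-cancelˡ-≡ m m' 2 (+-cancelˡ-≡ i _ _ eq)

even-step : ∀ {i} → 2 ∣ i → 2 ∣ suc (suc i)
even-step = ∣m∣n⇒∣m+n ∣-refl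

program-at-odd : ∀ {nAP nΣ} {𝒯 : KTS nAP nΣ} {p : Seq 𝒯} {i} →
                 InPaths* 𝒯 p → 2 ∣ i → ∃[ σ ] p (suc i) ≡ inj₂ σ
program-at-odd {p = p} (p' , j , (isPath , _) , p≡p') (divides a refl)
  with isPath (j + a)
... | _ , σ , _ , _ , odd≡σ , _ , _ = σ , (begin
  p (suc (a * 2))            ≡⟨ p≡p' (suc (a * 2)) ⟩
  p' (2 * j + suc (a * 2))   ≡⟨ cong p' (odd-position j a) ⟩
  p' (suc (2 * (j + a)))     ≡⟨ odd≡σ ⟩
  inj₂ σ                     ∎)

letter-at-odd : ∀ {nAP nΣ} {𝒯 : KTS nAP nΣ} {n} (Π : PA 𝒯 n) →
                (∀ l → InPaths* 𝒯 (Ππ Π l)) → ∀ {i} → 2 ∣ i → ∃[ w ] IsLetterAt Π (suc i) w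
letter-at-odd {𝒯 = 𝒯} Π paths {i} 2∣i = (λ l → proj₁ (program l)) , (λ l → proj₂ (program l))
  where
  program : ∀ l → ∃[ σ ] Ππ Π l (suc i) ≡ inj₂ σ
  program l = program-at-odd {𝒯 = 𝒯} {p = Ππ Π l} (paths l) 2∣i

match-transfer : ∀ {nS nS' nΣ} (t : Maybe (Fin nΣ)) {x : Fin nS ⊎ Fin nΣ} {y : Fin nS' ⊎ Fin nΣ} {σ} →
                 x ≡ inj₂ σ → y ≡ inj₂ σ → MatchProg t x → MatchProg t y
match-transfer nothing _ _ _ = tt
match-transfer (just _) refl refl refl = refl

module Runs {nAP nΣ : ℕ} {𝒯 : KTS nAP nΣ} {n : ℕ} (Π : PA 𝒯 n) where

  private
    Fm = Form {nAP} {nΣ} n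
    Pg = Prog {nAP} {nΣ} n

  Holds : List Fm → ℕ → Set
  Holds X i = ∀ ψ → ψ ∈ X → shiftΠ Π i ⊨ ψ

  holds-[] : ∀ {i} → Holds [] i
  holds-[] _ ()

  holds-++ : ∀ {X Y i} → Holds X i → Holds Y i → Holds (X ++ Y) i
  holds-++ {X} hX hY ψ ψ∈ = [ hX ψ , hY ψ ]′ (∈-++⁻ X ψ∈)

  holds-++ˡ : ∀ {X Y i} → Holds (X ++ Y) i → Holds X i
  holds-++ˡ h ψ ψ∈ = h ψ (∈-++⁺ˡ ψ∈)

  holds-++ʳ : ∀ {X Y i} → Holds (X ++ Y) i → Holds Y i
  holds-++ʳ {X} h ψ ψ∈ = h ψ (∈-++⁺ʳ X ψ∈)

  data Run (α : Pg) : ℕ → Q α → ℕ → Q α → Set where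
    stop   : ∀ {i q} → Holds (Ψ α q) i → Run α i q i q
    ε-move : ∀ {i q q' k q''} → Holds (Ψ α q) i → ρ α q nothing q' →
             Run α i q' k q'' → Run α i q k q''
    w-move : ∀ {i q w q' k q''} → Holds (Ψ α q) i → ρ α q (just w) q' → IsLetterAt Π (suc i) w →
             Run α (suc (suc i)) q' k q'' → Run α i q k q''

  run-even : ∀ {α i q k q'} → Run α i q k q' → 2 ∣ i → 2 ∣ k
  run-even (stop _) ev = ev
  run-even (ε-move _ _ r) ev = run-even r ev
  run-even (w-move _ _ _ r) ev = run-even r (even-step ev)

  run-≤ : ∀ {α i q k q'} → Run α i q k q' → i ≤ k
  run-≤ (stop _) = ≤-refl
  run-≤ (ε-move _ _ r) = run-≤ r
  run-≤ {i = i} (w-move _ _ _ r) = ≤-trans (m≤n+m i 2) (run-≤ r)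

  run-glue : ∀ {α i q k q' q'' l q'''} → Run α i q k q' → ρ α q' nothing q'' →
             Run α k q'' l q''' → Run α i q l q'''
  run-glue (stop h) e r = ε-move h e r
  run-glue (ε-move h e' r') e r = ε-move h e' (run-glue r' e r)
  run-glue (w-move h e' lt r') e r = w-move h e' lt (run-glue r' e r)

  -- A map of automata preserving edges and marks carries runs to runs; this covers the
  -- inclusions of M_α and M_β into M_{α+β}, M_{α·β} and M_{α*}.
  run-map : ∀ {α β} (f : Q α → Q β) → (∀ {q a q'} → ρ α q a q' → ρ β (f q) a (f q')) →
            (∀ q → Ψ β (f q) ≡ Ψ α q) → ∀ {i q k q'} → Run α i q k q' → Run β i (f q) k (f q')
  run-map f edge mark (stop h) = stop (subst (λ X → Holds X _) (sym (mark _)) h)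
  run-map f edge mark (ε-move h e r) =
    ε-move (subst (λ X → Holds X _) (sym (mark _)) h) (edge e) (run-map f edge mark r)
  run-map f edge mark (w-move h e lt r) =
    w-move (subst (λ X → Holds X _) (sym (mark _)) h) (edge e) lt (run-map f edge mark r)

  run-from-sink : ∀ {α i q k q'} → (∀ {a q''} → ¬ ρ α q a q'') → Run α i q k q' → i ≡ k
  run-from-sink sink (stop _) = refl
  run-from-sink sink (ε-move _ e _) = ⊥-elim (sink e)
  run-from-sink sink (w-move _ e _ _) = ⊥-elim (sink e)

  Iter : Pg → ℕ → ℕ → Set
  Iter α = Star (λ j j' → j ≤ j' × R α Π j j')

  HasLetters : Set
  HasLetters = ∀ {i} → 2 ∣ i → ∃[ w ] IsLetterAt Π (suc i) w

  -- M_{α*}: one pass through M_α per iteration, joined through the new q₀ and q_f.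
  iter⇒run : ∀ {α} → (∀ {i k} → 2 ∣ i → R α Π i k → Run α i (q₀ α) k (q_f α)) →
             ∀ {i k} → 2 ∣ i → Iter α i k → Run (α *') i (inj₁ zero) k (inj₁ (suc zero))
  iter⇒run pass ev ε = ε-move holds-[] *-skip (stop holds-[])
  iter⇒run {α} pass {i} ev (_◅_ {j = j} (_ , r) rest) =
    ε-move holds-[] *-in
      (run-glue (run-map inj₂ *-lift (λ _ → refl) first) *-out
        (ε-move holds-[] *-back (iter⇒run pass (run-even first ev) rest)))
    where
    first : Run α i (q₀ α) j (q_f α)
    first = pass ev r

  R⇒run : HasLetters → (α : Pg) → ∀ {i k} → 2 ∣ i → R α Π i k → Run α i (q₀ α) k (q_f α)
  R⇒run letters (τ t) {i} ev (k≡ , match) with letters ev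
  ... | w , lt = subst (λ k → Run (τ t) i zero k (suc zero)) (sym (trans k≡ (+-comm i 2)))
      (w-move holds-[] (τ-edge w (λ l → match-transfer (t l) (lt l) refl (match l))) lt (stop holds-[]))
  R⇒run letters eps ev refl = ε-move holds-[] ε-edge (stop holds-[])
  R⇒run letters (α +' β) ev (inj₁ r) =
    ε-move holds-[] +-in₁
      (run-glue (run-map (λ q → inj₂ (inj₁ q)) +-lift₁ (λ _ → refl) (R⇒run letters α ev r)) +-out₁
        (stop holds-[]))
  R⇒run letters (α +' β) ev (inj₂ r) =
    ε-move holds-[] +-in₂
      (run-glue (run-map (λ q → inj₂ (inj₂ q)) +-lift₂ (λ _ → refl) (R⇒run letters β ev r)) +-out₂
        (stop holds-[]))
  R⇒run letters (α · β) {i} ev (j , _ , _ , r₁ , r₂) =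
    run-glue (run-map inj₁ ·-lift₁ (λ _ → refl) first) ·-mid
      (run-map inj₂ ·-lift₂ (λ _ → refl) (R⇒run letters β (run-even first ev) r₂))
    where
    first : Run α i (q₀ α) j (q_f α)
    first = R⇒run letters α ev r₁
  R⇒run letters (α *') ev iter = iter⇒run (R⇒run letters α) ev iter
  R⇒run letters (φ ¿) {i} ev (refl , φ-holds) =
    ε-move holds-[] ¿-01 (ε-move holds-φ ¿-12 (stop holds-[]))
    where
    holds-φ : Holds (φ ∷ []) i
    holds-φ _ (here refl) = φ-holds

  unplus₁ : ∀ {α β i q k} → Run (α +' β) i (inj₂ (inj₁ q)) k (inj₁ (suc zero)) → Run α i q k (q_f α)
  unplus₁ {α} {i = i} (ε-move h +-out₁ r) =
    subst (λ k → Run α i (q_f α) k (q_f α)) (run-from-sink (λ ()) r) (stop h)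
  unplus₁ (ε-move h (+-lift₁ e) r) = ε-move h e (unplus₁ r)
  unplus₁ (w-move h (+-lift₁ e) lt r) = w-move h e lt (unplus₁ r)

  unplus₂ : ∀ {α β i q k} → Run (α +' β) i (inj₂ (inj₂ q)) k (inj₁ (suc zero)) → Run β i q k (q_f β)
  unplus₂ {β = β} {i = i} (ε-move h +-out₂ r) =
    subst (λ k → Run β i (q_f β) k (q_f β)) (run-from-sink (λ ()) r) (stop h)
  unplus₂ (ε-move h (+-lift₂ e) r) = ε-move h e (unplus₂ r)
  unplus₂ (w-move h (+-lift₂ e) lt r) = w-move h e lt (unplus₂ r)

  unseq₂ : ∀ {α β i q k q'} → Run (α · β) i (inj₂ q) k (inj₂ q') → Run β i q k q'
  unseq₂ (stop h) = stop h
  unseq₂ (ε-move h (·-lift₂ e) r) = ε-move h e (unseq₂ r)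
  unseq₂ (w-move h (·-lift₂ e) lt r) = w-move h e lt (unseq₂ r)

  -- A run of M_{α·β} into the copy of M_β splits at the unique crossing edge.
  unseq : ∀ {α β i q k} → Run (α · β) i (inj₁ q) k (inj₂ (q_f β)) →
          ∃[ j ] (i ≤ j × j ≤ k × Run α i q j (q_f α) × Run β j (q₀ β) k (q_f β))
  unseq {i = i} (ε-move h ·-mid r) = i , ≤-refl , run-≤ (unseq₂ r) , stop h , unseq₂ r
  unseq (ε-move h (·-lift₁ e) r) with unseq r
  ... | j , i≤j , j≤k , r₁ , r₂ = j , i≤j , j≤k , ε-move h e r₁ , r₂
  unseq {i = i} (w-move h (·-lift₁ e) lt r) with unseq r
  ... | j , i≤j , j≤k , r₁ , r₂ = j , ≤-trans (m≤n+m i 2) i≤j , j≤k , w-move h e lt r₁ , r₂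

  -- What a run of M_{α*} to the new q_f means, by its starting state: from the new q₀ or q_f
  -- it is an iteration; from inside M_α it first finishes a pass of α, then iterates.
  IterFrom : (α : Pg) → Q (α *') → ℕ → ℕ → Set
  IterFrom α (inj₁ _) i k = Iter α i k
  IterFrom α (inj₂ q) i k = ∃[ j ] (i ≤ j × Run α i q j (q_f α) × Iter α j k)

  run⇒iter : ∀ {α} → (∀ {i k} → Run α i (q₀ α) k (q_f α) → R α Π i k) →
             ∀ {i s k} → Run (α *') i s k (inj₁ (suc zero)) → IterFrom α s i k
  run⇒iter pass (stop h) = ε
  run⇒iter pass (ε-move h *-in r) with run⇒iter pass r
  ... | j , i≤j , r₁ , rest = (i≤j , pass r₁) ◅ rest
  run⇒iter pass (ε-move h *-skip r) = run⇒iter pass r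
  run⇒iter pass (ε-move h *-back r) = run⇒iter pass r
  run⇒iter pass {i} (ε-move h *-out r) = i , ≤-refl , stop h , run⇒iter pass r
  run⇒iter pass (ε-move h (*-lift e) r) with run⇒iter pass r
  ... | j , i≤j , r₁ , rest = j , i≤j , ε-move h e r₁ , rest
  run⇒iter pass {i} (w-move h (*-lift e) lt r) with run⇒iter pass r
  ... | j , i≤j , r₁ , rest = j , ≤-trans (m≤n+m i 2) i≤j , w-move h e lt r₁ , rest

  run⇒R : (α : Pg) → ∀ {i k} → Run α i (q₀ α) k (q_f α) → R α Π i k
  run⇒R (τ t) {i} (w-move h (τ-edge w match) lt r) =
    trans (sym (run-from-sink (λ ()) r)) (+-comm 2 i) , λ l → match-transfer (t l) refl (lt l) (match l)
  run⇒R eps (ε-move h ε-edge r) = run-from-sink (λ ()) r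
  run⇒R (α +' β) (ε-move h +-in₁ r) = inj₁ (run⇒R α (unplus₁ r))
  run⇒R (α +' β) (ε-move h +-in₂ r) = inj₂ (run⇒R β (unplus₂ r))
  run⇒R (α · β) r with unseq r
  ... | j , i≤j , j≤k , r₁ , r₂ = j , i≤j , j≤k , run⇒R α r₁ , run⇒R β r₂
  run⇒R (α *') r = run⇒iter (run⇒R α) r
  run⇒R (φ ¿) (ε-move _ ¿-01 (ε-move h ¿-12 r)) = run-from-sink (λ ()) r , h φ (here refl)
  run⇒R (φ ¿) (ε-move _ ¿-01 (w-move _ () _ _))

  data Blocks (α : Pg) : ℕ → Q α → ℕ → Set where
    last  : ∀ {i q X} → α ⊢ q ⇒ε[ X ] q_f α → Holds X i → Blocks α i q zero
    block : ∀ {i q X w q'' m} → α ⊢ q ⇒⟨ w ⟩[ X ] q'' → IsLetterAt Π (suc i) w → Holds X i →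
            Blocks α (suc (suc i)) q'' m → Blocks α i q (suc m)

  blocks-ε : ∀ {α i q q' m} → Holds (Ψ α q) i → ρ α q nothing q' → Blocks α i q' m → Blocks α i q m
  blocks-ε h e (last c hX) = last (⇒ε-step e c) (holds-++ hX h)
  blocks-ε h e (block (q₁ , c , e') lt hX bs) = block (q₁ , ⇒ε-step e c , e') lt (holds-++ hX h) bs

  run⇒blocks : ∀ {α i q k} → Run α i q k (q_f α) → Σ ℕ λ m → k ≡ i + 2 * m × Blocks α i q m
  run⇒blocks {i = i} (stop h) = 0 , sym (+-identityʳ i) , last ⇒ε-refl h
  run⇒blocks (ε-move h e r) with run⇒blocks r
  ... | m , k≡ , bs = m , k≡ , blocks-ε h e bs
  run⇒blocks {i = i} (w-move h e lt r) with run⇒blocks r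
  ... | m , k≡ , bs = suc m , trans k≡ (next-block i m) , block (_ , ⇒ε-refl , e) lt h bs

  unfold-ε : ∀ {α i q X q' k q''} → α ⊢ q ⇒ε[ X ] q' → Holds X i →
             (Holds (Ψ α q') i → Run α i q' k q'') → Run α i q k q''
  unfold-ε ⇒ε-refl hX continue = continue hX
  unfold-ε (⇒ε-step e c) hX continue = ε-move (holds-++ʳ hX) e (unfold-ε c (holds-++ˡ hX) continue)

  blocks⇒run : ∀ {α i q m} → Blocks α i q m → Run α i q (i + 2 * m) (q_f α)
  blocks⇒run {α} {i} {q} (last c hX) =
    subst (λ k → Run α i q k (q_f α)) (sym (+-identityʳ i)) (unfold-ε c hX stop)
  blocks⇒run {α} {i} (block {q'' = q''} {m = m} (_ , c , e) lt hX bs) =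
    unfold-ε c hX λ h →
      w-move h e lt (subst (λ k → Run α (suc (suc i)) q'' k (q_f α)) (next-block i m) (blocks⇒run bs))

  Accepting : (α : Pg) → ℕ → Q α → ℕ → Set
  Accepting α i q m =
    Σ (Fin (suc m) → Q α) λ q' → Σ (Fin (suc m) → List Fm) λ X →
        (q' zero ≡ q)
        × (α ⊢ q' (fromℕ m) ⇒ε[ X (fromℕ m) ] q_f α)
        × (∀ (l : Fin m) → ∃[ w ] (IsLetterAt Π (i + 2 * toℕ l + 1) w
              × α ⊢ q' (inject₁ l) ⇒⟨ w ⟩[ X (inject₁ l) ] q' (suc l)))
        × (∀ (l : Fin (suc m)) (ψ : Fm) → ψ ∈ X l → shiftΠ Π (i + 2 * toℕ l) ⊨ ψ)

  -- Truth of a formula and the letter read are transported along equal positions; the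
  -- positions to be identified are i + 0 with i, and position l of a run from i + 2 with
  -- position l + 1 of the same run from i (next-block).
  holds-at : ∀ {ψ p p'} → p ≡ p' → shiftΠ Π p ⊨ ψ → shiftΠ Π p' ⊨ ψ
  holds-at {ψ} = subst (λ p → shiftΠ Π p ⊨ ψ)

  letter-at : ∀ {w p p'} → p ≡ p' → IsLetterAt Π p w → IsLetterAt Π p' w
  letter-at {w} = subst (λ p → IsLetterAt Π p w)

  blocks⇒accepting : ∀ {α i q m} → Blocks α i q m → Accepting α i q m
  blocks⇒accepting {α} {i} {q} (last {X = X} c hX) =
    (λ _ → q) , (λ _ → X) , refl , c , (λ ()) , λ { zero ψ ψ∈ → holds-at (sym (+-identityʳ i)) (hX ψ ψ∈) }
  blocks⇒accepting {α} {i} {q} {suc m} (block {X = X} {w = w} step lt hX bs)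
    with blocks⇒accepting bs
  ... | qs , Xs , refl , final , steps , holds = q' , X' , refl , final , steps' , holds'
    where
    q' : Fin (suc (suc m)) → Q α
    q' zero = q
    q' (suc l) = qs l
    X' : Fin (suc (suc m)) → List Fm
    X' zero = X
    X' (suc l) = Xs l
    steps' : ∀ (l : Fin (suc m)) → ∃[ w ] (IsLetterAt Π (i + 2 * toℕ l + 1) w
               × α ⊢ q' (inject₁ l) ⇒⟨ w ⟩[ X' (inject₁ l) ] q' (suc l))
    steps' zero = w , letter-at (first-letter i) lt , step
    steps' (suc l) with steps l
    ... | w' , lt' , step' = w' , letter-at (cong (_+ 1) (next-block i (toℕ l))) lt' , step'
    holds' : ∀ (l : Fin (suc (suc m))) (ψ : Fm) → ψ ∈ X' l → shiftΠ Π (i + 2 * toℕ l) ⊨ ψ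
    holds' zero ψ ψ∈ = holds-at (sym (+-identityʳ i)) (hX ψ ψ∈)
    holds' (suc l) ψ ψ∈ = holds-at (next-block i (toℕ l)) (holds l ψ ψ∈)

  accepting⇒blocks : ∀ {α i q} m → Accepting α i q m → Blocks α i q m
  accepting⇒blocks {i = i} zero (_ , _ , refl , final , _ , holds) =
    last final (λ ψ ψ∈ → holds-at (+-identityʳ i) (holds zero ψ ψ∈))
  accepting⇒blocks {α} {i} (suc m) (qs , Xs , refl , final , steps , holds) with steps zero
  ... | w , lt , step =
    block step (letter-at (sym (first-letter i)) lt) (λ ψ ψ∈ → holds-at (+-identityʳ i) (holds zero ψ ψ∈))
          (accepting⇒blocks m ((λ l → qs (suc l)) , (λ l → Xs (suc l)) , refl , final , steps' , holds'))
    where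
    steps' : ∀ (l : Fin m) → ∃[ w ] (IsLetterAt Π (suc (suc i) + 2 * toℕ l + 1) w
               × α ⊢ qs (suc (inject₁ l)) ⇒⟨ w ⟩[ Xs (suc (inject₁ l)) ] qs (suc (suc l)))
    steps' l with steps (suc l)
    ... | w' , lt' , step' = w' , letter-at (cong (_+ 1) (sym (next-block i (toℕ l)))) lt' , step'
    holds' : ∀ (l : Fin (suc m)) (ψ : Fm) → ψ ∈ Xs (suc l) → shiftΠ Π (suc (suc i) + 2 * toℕ l) ⊨ ψ
    holds' l ψ ψ∈ = holds-at (sym (next-block i (toℕ l))) (holds (suc l) ψ ψ∈)

lemma5 : ∀ {nAP nΣ} (𝒯 : KTS nAP nΣ) (n : ℕ) (α : Prog {nAP} {nΣ} n) (Π : PA 𝒯 n) →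
    InPaths* 𝒯 (Πε Π) → (∀ l → InPaths* 𝒯 (Ππ Π l)) →
    ∀ i k → 2 ∣ i → 2 ∣ k → i ≤ k →
    let m = ⌊ (k ∸ i) /2⌋ in
    R α Π i k ⇔
      (Σ (Fin (suc m) → Q α) λ q' → Σ (Fin (suc m) → List (Form {nAP} {nΣ} n)) λ X →
        (q' zero ≡ q₀ α)
        × (α ⊢ q' (fromℕ m) ⇒ε[ X (fromℕ m) ] q_f α)
        × (∀ (l : Fin m) → ∃[ w ] (IsLetterAt Π (i + 2 * toℕ l + 1) w
              × α ⊢ q' (inject₁ l) ⇒⟨ w ⟩[ X (inject₁ l) ] q' (suc l)))
        × (∀ (l : Fin (suc m)) (ψ : Form {nAP} {nΣ} n) → ψ ∈ X l → shiftΠ Π (i + 2 * toℕ l) ⊨ ψ))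
lemma5 𝒯 n α Π _ program-paths i k 2∣i 2∣k i≤k = mk⇔ sound complete
  where
  open Runs Π
  m : ℕ
  m = ⌊ (k ∸ i) /2⌋
  k≡ : k ≡ i + 2 * m
  k≡ = even-gap 2∣i 2∣k i≤k

  -- R(α) ⇒ checked run ⇒ blocks, whose number is forced to be m by the end position k.
  sound : R α Π i k → Accepting α i (q₀ α) m
  sound r with run⇒blocks (R⇒run (letter-at-odd Π program-paths) α 2∣i r)
  ... | m' , k≡' , bs =
    blocks⇒accepting (subst (Blocks α i (q₀ α)) (steps-unique i (trans (sym k≡') k≡)) bs)

  complete : Accepting α i (q₀ α) m → R α Π i k
  complete acc =
    run⇒R α (subst (λ k → Run α i (q₀ α) k (q_f α)) (sym k≡) (blocks⇒run (accepting⇒blocks m acc)))
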